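{- For a positive integer $m$ let $h(m)=2^{v_2(m)}3^{v_3(m)}$, and define the step map $S:\mathbb{Z}_{>0}\to\mathbb{Z}_{>0}$ by $S(m)=h(5m+1)$. Then every cycle of $S$ (a finite set $\{m_0,\dots,m_{k-1}\}$ of distinct positive integers with $S(m_i)=m_{i+1 \bmod k}$) contains exactly two elements.
   Context: $v_p(m)$ denotes the exponent of the prime $p$ in $m$; $h(m)$ is the largest divisor of $m$ whose only prime factors are $2$ and $3$. The map $S$ is one "step" of the holdout process: apply $m\mapsto 5m+1$ and then remove all prime factors other than $2$ and $3$. -}

module Defs where

open import Data.Nat using (ℕ; zero; suc; _+_; _*_; _^_; _%_; _/_)
open import Data.Nat.Properties using (_≟_)
open import Relation.Nullary using (yes; no)

-- p-adic valuation with fuel: number of times p divides m (fuel steps at most).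
-- For m > 0 and p ≥ 2, fuel m suffices since p^(v_p m) ≤ m.
vAux : ℕ → (p : ℕ) → .{{_ : Data.Nat.NonZero p}} → ℕ → ℕ
vAux zero    p m = zero
vAux (suc f) p m with m % p ≟ 0
... | yes _ = suc (vAux f p (m / p))
... | no  _ = zero

v : (p : ℕ) → .{{_ : Data.Nat.NonZero p}} → ℕ → ℕ
v p m = vAux m p m

h : ℕ → ℕ
h m = 2 ^ v 2 m * 3 ^ v 3 m

S : ℕ → ℕ
S m = h (5 * m + 1)

-- Write 5n + 1 = h(5n + 1) · q. The cofactor q is prime to 2, 3 and 5, so either q = 1 or
-- q ≥ 7, and then S n = h(5n + 1) ≤ (5n + 1)/7 < n. Hence S strictly decreases along a cycle
-- until it meets some n = 2^a 3^b with 5n + 1 = 2^c 3^d. Parity, divisibility by 3 and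
-- congruences modulo 13, 63 and 544 show that n ∈ {1, 3, 16}, and the orbits of these all
-- fall into 1 → 6 → 1; a cycle through 1 is therefore {1, 6}.
module Submission where

open import Defs
open import Algebra.Properties.CommutativeSemigroup using (x∙yz≈y∙xz)
open import Data.Empty using (⊥-elim)
open import Data.Fin using (Fin; zero; toℕ; fromℕ<)
open import Data.Fin.Properties using (toℕ-fromℕ<; toℕ-injective; toℕ<n)
open import Data.Nat
open import Data.Nat.DivMod
open import Data.Nat.Divisibility
open import Data.Nat.GeneralisedArithmetic using (iterate)
open import Data.Nat.Induction using (<-wellFounded)
open import Data.Nat.Primality using (Prime; prime?; euclidsLemma)
open import Data.Nat.Properties
open import Data.Product using (∃; ∃-syntax; _×_; _,_)
open import Data.Sum using (_⊎_; inj₁; inj₂; map₂; swap)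
open import Function using (_∘_)
open import Function.Definitions using (Injective)
open import Induction.WellFounded using (Acc; acc)
open import Relation.Binary.PropositionalEquality
open import Relation.Nullary
open import Relation.Nullary.Decidable using (from-yes)

x*[y*z]≡y*[x*z] : ∀ x y z → x * (y * z) ≡ y * (x * z)
x*[y*z]≡y*[x*z] = x∙yz≈y∙xz *-commutativeSemigroup

module _ {M : ℕ} .{{_ : NonZero M}} where

  open ≡-Reasoning

  %-cong-*ˡ : ∀ c {x y} → x % M ≡ y % M → c * x % M ≡ c * y % M
  %-cong-*ˡ c {x} {y} x≡y = begin
    c * x % M              ≡⟨ %-distribˡ-* c x M ⟩
    c % M * (x % M) % M    ≡⟨ cong (λ r → c % M * r % M) x≡y ⟩
    c % M * (y % M) % M    ≡⟨ %-distribˡ-* c y M ⟨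
    c * y % M              ∎

  %-cong-+ʳ : ∀ c {x y} → x % M ≡ y % M → (x + c) % M ≡ (y + c) % M
  %-cong-+ʳ c {x} {y} x≡y = begin
    (x + c) % M            ≡⟨ %-distribˡ-+ x c M ⟩
    (x % M + c % M) % M    ≡⟨ cong (λ r → (r + c % M) % M) x≡y ⟩
    (y % M + c % M) % M    ≡⟨ %-distribˡ-+ y c M ⟨
    (y + c) % M            ∎

  module _ {a g p : ℕ} (period : a * g ^ p % M ≡ a % M) where

    ^-multiple-of-period : ∀ k → a * g ^ (k * p) % M ≡ a % M
    ^-multiple-of-period zero    = cong (_% M) (*-identityʳ a)
    ^-multiple-of-period (suc k) = begin
      a * g ^ (p + k * p) % M        ≡⟨ cong (λ x → a * x % M) (^-distribˡ-+-* g p (k * p)) ⟩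
      a * (g ^ p * g ^ (k * p)) % M  ≡⟨ cong (_% M) (x*[y*z]≡y*[x*z] a (g ^ p) (g ^ (k * p))) ⟩
      g ^ p * (a * g ^ (k * p)) % M  ≡⟨ %-cong-*ˡ (g ^ p) (^-multiple-of-period k) ⟩
      g ^ p * a % M                  ≡⟨ cong (_% M) (*-comm (g ^ p) a) ⟩
      a * g ^ p % M                  ≡⟨ period ⟩
      a % M                          ∎

    ^-mod-period : .{{_ : NonZero p}} → ∀ e → a * g ^ e % M ≡ a * g ^ (e % p) % M
    ^-mod-period e = begin
      a * g ^ e % M                  ≡⟨ cong (λ d → a * g ^ d % M) (m≡m%n+[m/n]*n e p) ⟩
      a * g ^ (r + k * p) % M        ≡⟨ cong (λ x → a * x % M) (^-distribˡ-+-* g r (k * p)) ⟩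
      a * (g ^ r * g ^ (k * p)) % M  ≡⟨ cong (_% M) (x*[y*z]≡y*[x*z] a (g ^ r) (g ^ (k * p))) ⟩
      g ^ r * (a * g ^ (k * p)) % M  ≡⟨ %-cong-*ˡ (g ^ r) (^-multiple-of-period k) ⟩
      g ^ r * a % M                  ≡⟨ cong (_% M) (*-comm (g ^ r) a) ⟩
      a * g ^ r % M                  ∎
      where
      r = e % p
      k = e / p

module _ (M : ℕ) .{{_ : NonZero M}} where

  AvoidsPowers : (x b k q : ℕ) → Set
  AvoidsPowers x b k q = ∀ {j} → j < q → x % M ≢ b * k ^ j % M

  avoidsPowers? : ∀ x b k q → Dec (AvoidsPowers x b k q)
  avoidsPowers? x b k q = allUpTo? (λ j → ¬? (x % M ≟ b * k ^ j % M)) q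

  ≢-power : ∀ x b k q .{{_ : NonZero q}} → b * k ^ q % M ≡ b % M →
            AvoidsPowers x b k q → ∀ f → x ≢ b * k ^ f
  ≢-power x b k q period avoids f x≡b*k^f =
    avoids (m%n<n f q) (trans (cong (_% M) x≡b*k^f) (^-mod-period period f))

  Avoids5*+1 : (a g p b k q : ℕ) → Set
  Avoids5*+1 a g p b k q = ∀ {i} → i < p → AvoidsPowers (5 * (a * g ^ i) + 1) b k q

  avoids5*+1? : ∀ a g p b k q → Dec (Avoids5*+1 a g p b k q)
  avoids5*+1? a g p b k q = allUpTo? (λ i → avoidsPowers? (5 * (a * g ^ i) + 1) b k q) p

  5*power+1≢power : ∀ a g p b k q .{{_ : NonZero p}} .{{_ : NonZero q}} →
                    a * g ^ p % M ≡ a % M → b * k ^ q % M ≡ b % M →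
                    Avoids5*+1 a g p b k q → ∀ e f → 5 * (a * g ^ e) + 1 ≢ b * k ^ f
  5*power+1≢power a g p b k q periodˡ periodʳ avoids e = ≢-power _ b k q periodʳ λ j<q eq →
    avoids (m%n<n e p) j<q (trans (sym (%-cong-+ʳ {M} 1 (%-cong-*ˡ {M} 5 (^-mod-period {M} periodˡ e)))) eq)

∣⇒∤+1 : ∀ {d m} → 1 < d → d ∣ m → ¬ d ∣ m + 1
∣⇒∤+1 1<d d∣m d∣m+1 = <⇒≱ 1<d (∣⇒≤ (∣m+n∣m⇒∣n d∣m+1 d∣m))

∤⇒≢0 : ∀ {d n} → ¬ d ∣ n → NonZero n
∤⇒≢0 {d} {zero}  d∤0 = ⊥-elim (d∤0 (d ∣0))
∤⇒≢0 {n = suc _} _   = _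

prime∤c^a*q : ∀ {p c q} → Prime p → ¬ p ∣ c → ¬ p ∣ q → ∀ a → ¬ p ∣ c ^ a * q
prime∤c^a*q {p} {c} {q} _ _ p∤q zero = p∤q ∘ subst (p ∣_) (*-identityˡ q)
prime∤c^a*q {p} {c} {q} p-prime p∤c p∤q (suc a) p∣c^[1+a]*q
  with euclidsLemma c (c ^ a * q) p-prime (subst (p ∣_) (*-assoc c (c ^ a) q) p∣c^[1+a]*q)
... | inj₁ p∣c     = p∤c p∣c
... | inj₂ p∣c^a*q = prime∤c^a*q p-prime p∤c p∤q a p∣c^a*q

module _ (p : ℕ) .{{_ : NonZero p}} (1<p : 1 < p) where

  open ≡-Reasoning

  vAux-∤ : ∀ {f m} → ¬ p ∣ m → vAux (suc f) p m ≡ 0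
  vAux-∤ {f} {m} p∤m with m % p ≟ 0
  ... | yes m%p≡0 = ⊥-elim (p∤m (m%n≡0⇒n∣m m p m%p≡0))
  ... | no  _     = refl

  vAux-∣ : ∀ {f m} → p ∣ m → vAux (suc f) p m ≡ suc (vAux f p (m / p))
  vAux-∣ {f} {m} p∣m with m % p ≟ 0
  ... | yes _     = refl
  ... | no  m%p≢0 = ⊥-elim (m%p≢0 (n∣m⇒m%n≡0 m p p∣m))

  vAux-factorisation : ∀ f m → 0 < m → m ≤ f → ∃[ q ] m ≡ p ^ vAux f p m * q × ¬ p ∣ q
  vAux-factorisation zero    m 0<m m≤0 = ⊥-elim (<⇒≱ 0<m m≤0)
  vAux-factorisation (suc f) m 0<m m≤1+f with p ∣? m
  ... | no  p∤m rewrite vAux-∤ {f} p∤m = m , sym (*-identityˡ m) , p∤m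
  ... | yes p∣m rewrite vAux-∣ {f} p∣m =
    let q , m/p≡p^v*q , p∤q = vAux-factorisation f (m / p) m/p>0 m/p≤f
    in q , (begin
      m                                ≡⟨ m*[n/m]≡n p∣m ⟨
      p * (m / p)                      ≡⟨ cong (p *_) m/p≡p^v*q ⟩
      p * (p ^ vAux f p (m / p) * q)   ≡⟨ *-assoc p _ q ⟨
      p * p ^ vAux f p (m / p) * q     ∎) , p∤q
    where
    instance _ = >-nonZero 0<m
    m/p>0 : 0 < m / p
    m/p>0 = m≥n⇒m/n>0 (∣⇒≤ p∣m)
    m/p≤f : m / p ≤ f
    m/p≤f = s≤s⁻¹ (<-≤-trans (m/n<m m p 1<p) m≤1+f)

  v-factorisation : ∀ m → 0 < m → ∃[ q ] m ≡ p ^ v p m * q × ¬ p ∣ q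
  v-factorisation m 0<m = vAux-factorisation m m 0<m ≤-refl

  vAux-unique : ∀ f e q → ¬ p ∣ q → p ^ e * q ≤ f → vAux f p (p ^ e * q) ≡ e
  vAux-unique zero e q p∤q p^e*q≤0 = ⊥-elim (<⇒≱ (>-nonZero⁻¹ (p ^ e * q)) p^e*q≤0)
    where
    instance
      _ = ∤⇒≢0 p∤q
      _ = m^n≢0 p e
      _ = m*n≢0 (p ^ e) q
  vAux-unique (suc f) zero q p∤q _ = vAux-∤ (p∤q ∘ subst (p ∣_) (*-identityˡ q))
  vAux-unique (suc f) (suc e) q p∤q p^[1+e]*q≤1+f = begin
    vAux (suc f) p (p ^ suc e * q)      ≡⟨ vAux-∣ (∣m⇒∣m*n q (m∣m*n (p ^ e))) ⟩
    suc (vAux f p (p ^ suc e * q / p))  ≡⟨ cong (λ m → suc (vAux f p (m / p))) p^[1+e]*q≡x*p ⟩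
    suc (vAux f p (x * p / p))          ≡⟨ cong (λ m → suc (vAux f p m)) (m*n/n≡m x p) ⟩
    suc (vAux f p x)                    ≡⟨ cong suc (vAux-unique f e q p∤q x≤f) ⟩
    suc e                               ∎
    where
    x = p ^ e * q
    instance
      _ = ∤⇒≢0 p∤q
      _ = m^n≢0 p e
      _ = m*n≢0 (p ^ e) q
    p^[1+e]*q≡x*p : p ^ suc e * q ≡ x * p
    p^[1+e]*q≡x*p = trans (*-assoc p (p ^ e) q) (*-comm p x)
    x≤f : x ≤ f
    x≤f = s≤s⁻¹ (<-≤-trans (m<m*n x p 1<p) (subst (_≤ suc f) p^[1+e]*q≡x*p p^[1+e]*q≤1+f))

  v-unique : ∀ e q → ¬ p ∣ q → v p (p ^ e * q) ≡ e
  v-unique e q p∤q = vAux-unique (p ^ e * q) e q p∤q ≤-refl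

module _ {a ℓ} {A : Set a} {P : A → Set ℓ} (μ : A → ℕ) (f : A → A)
         (descends : ∀ x → P x ⊎ μ (f x) < μ x) where

  descent : A → ∃ P
  descent x = go x (<-wellFounded (μ x))
    where
    go : ∀ x → Acc _<_ (μ x) → ∃ P
    go x (acc rs) with descends x
    ... | inj₁ Px       = x , Px
    ... | inj₂ μ[fx]<μx = go (f x) (rs μ[fx]<μx)

iterate-equivariant : ∀ {a b} {A : Set a} {B : Set b} {ρ : A → A} {f : B → B} (m : A → B) →
                      (∀ x → f (m x) ≡ m (ρ x)) → ∀ x j → iterate f (m x) j ≡ m (iterate ρ x j)
iterate-equivariant             m comm x zero    = refl
iterate-equivariant {ρ = ρ} {f} m comm x (suc j) =
  trans (cong (λ y → iterate f y j) (comm x)) (iterate-equivariant {ρ = ρ} {f} m comm (ρ x) j)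

rotate : ∀ {k} → Fin (suc k) → Fin (suc k)
rotate {k} i = fromℕ< (m%n<n (suc (toℕ i)) (suc k))

1+[1+t%n]%n≡t⇒n≡2 : ∀ {n t} .{{_ : NonZero n}} → t < n →
                    suc (suc t % n) % n ≡ t → suc t % n ≢ t → n ≡ 2
1+[1+t%n]%n≡t⇒n≡2 {n} {t} t<n returns moves with m≤n⇒m<n∨m≡n t<n
... | inj₂ refl =
  wrap-around t (trans (cong (λ r → suc r % n) (sym (n%n≡0 n))) returns) (moves ∘ trans (n%n≡0 n))
  where
  wrap-around : ∀ t → 1 % suc t ≡ t → 0 ≢ t → suc t ≡ 2
  wrap-around zero     _   0≢0 = ⊥-elim (0≢0 refl)
  wrap-around (suc t′) 1≡t _   = cong suc (trans (sym 1≡t) (m<n⇒m%n≡m {n = 2 + t′} {m = 1} (s<s z<s)))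
... | inj₁ 1+t<n = no-wrap (m≤n⇒m<n∨m≡n 1+t<n)
                     (trans (cong (λ r → suc r % n) (sym (m<n⇒m%n≡m 1+t<n))) returns)
  where
  no-wrap : 2 + t < n ⊎ 2 + t ≡ n → (2 + t) % n ≡ t → n ≡ 2
  no-wrap (inj₁ 2+t<n) 2+t%n≡t = ⊥-elim (<⇒≢ (m<n+m t {2} z<s) (trans (sym 2+t%n≡t) (m<n⇒m%n≡m 2+t<n)))
  no-wrap (inj₂ 2+t≡n) 2+t%n≡t =
    trans (sym 2+t≡n) (cong (2 +_) (trans (sym 2+t%n≡t) (trans (cong (_% n) 2+t≡n) (n%n≡0 n))))

rotate²≡id⇒order-2 : ∀ {k} (i : Fin (suc k)) → rotate (rotate i) ≡ i → rotate i ≢ i → suc k ≡ 2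
rotate²≡id⇒order-2 {k} i returns moves =
  1+[1+t%n]%n≡t⇒n≡2 (toℕ<n i)
    (trans (sym (trans (toℕ-rotate (rotate i)) (cong (λ r → suc r % suc k) (toℕ-rotate i)))) (cong toℕ returns))
    (moves ∘ toℕ-injective ∘ trans (toℕ-rotate i))
  where
  toℕ-rotate : ∀ j → toℕ (rotate j) ≡ suc (toℕ j) % suc k
  toℕ-rotate j = toℕ-fromℕ< (m%n<n (suc (toℕ j)) (suc k))

3-prime : Prime 3
3-prime = from-yes (prime? 3)

h>0 : ∀ N → 0 < h N
h>0 N = *-mono-≤ (m^n>0 2 (v 2 N)) (m^n>0 3 (v 3 N))

h-cofactor : ∀ N → 0 < N → ∃[ q ] N ≡ h N * q × ¬ 2 ∣ q × ¬ 3 ∣ q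
h-cofactor N 0<N with v-factorisation 2 (s<s z<s) N 0<N
... | s , N≡2^a*s , 2∤s with v-factorisation 3 (s<s z<s) s (>-nonZero⁻¹ s {{∤⇒≢0 2∤s}})
... | q , s≡3^e*q , 3∤q = q , N≡hN*q , 2∤q , 3∤q
  where
  open ≡-Reasoning
  a = v 2 N
  e = v 3 s
  N≡2^a*[3^e*q] : N ≡ 2 ^ a * (3 ^ e * q)
  N≡2^a*[3^e*q] = trans N≡2^a*s (cong (2 ^ a *_) s≡3^e*q)
  v3N≡e : v 3 N ≡ e
  v3N≡e = begin
    v 3 N                      ≡⟨ cong (v 3) N≡2^a*[3^e*q] ⟩
    v 3 (2 ^ a * (3 ^ e * q))  ≡⟨ cong (v 3) (x*[y*z]≡y*[x*z] (2 ^ a) (3 ^ e) q) ⟩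
    v 3 (3 ^ e * (2 ^ a * q))  ≡⟨ v-unique 3 (s<s z<s) e (2 ^ a * q) (prime∤c^a*q 3-prime 3∤2 3∤q a) ⟩
    e                          ∎
    where
    3∤2 : ¬ 3 ∣ 2
    3∤2 = <⇒≱ (n<1+n 2) ∘ ∣⇒≤
  N≡hN*q : N ≡ h N * q
  N≡hN*q = begin
    N                    ≡⟨ N≡2^a*[3^e*q] ⟩
    2 ^ a * (3 ^ e * q)  ≡⟨ *-assoc (2 ^ a) (3 ^ e) q ⟨
    2 ^ a * 3 ^ e * q    ≡⟨ cong (λ d → 2 ^ a * 3 ^ d * q) v3N≡e ⟨
    h N * q              ∎
  2∤q : ¬ 2 ∣ q
  2∤q 2∣q = 2∤s (subst (2 ∣_) (sym s≡3^e*q) (∣n⇒∣m*n (3 ^ e) 2∣q))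

coprime-to-30⇒≡1⊎≥7 : ∀ q → ¬ 2 ∣ q → ¬ 3 ∣ q → ¬ 5 ∣ q → q ≡ 1 ⊎ 7 ≤ q
coprime-to-30⇒≡1⊎≥7 0 2∤q _   _   = ⊥-elim (2∤q (2 ∣0))
coprime-to-30⇒≡1⊎≥7 1 _   _   _   = inj₁ refl
coprime-to-30⇒≡1⊎≥7 2 2∤q _   _   = ⊥-elim (2∤q ∣-refl)
coprime-to-30⇒≡1⊎≥7 3 _   3∤q _   = ⊥-elim (3∤q ∣-refl)
coprime-to-30⇒≡1⊎≥7 4 2∤q _   _   = ⊥-elim (2∤q (divides 2 refl))
coprime-to-30⇒≡1⊎≥7 5 _   _   5∤q = ⊥-elim (5∤q ∣-refl)
coprime-to-30⇒≡1⊎≥7 6 2∤q _   _   = ⊥-elim (2∤q (divides 3 refl))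
coprime-to-30⇒≡1⊎≥7 (suc (suc (suc (suc (suc (suc (suc q))))))) _ _ _ = inj₂ (m≤m+n 7 q)

*≥7⇒< : ∀ {t q n} → t * q ≡ 5 * n + 1 → 7 ≤ q → 0 < n → t < n
*≥7⇒< {t} {q} {n} t*q≡5n+1 7≤q 0<n = *-cancelˡ-< 7 t n (begin-strict
  7 * t          ≡⟨ *-comm 7 t ⟩
  t * 7          ≤⟨ *-monoʳ-≤ t 7≤q ⟩
  t * q          ≡⟨ t*q≡5n+1 ⟩
  5 * n + 1      <⟨ +-monoʳ-< (5 * n) (*-monoʳ-≤ 2 0<n) ⟩
  5 * n + 2 * n  ≡⟨ *-distribʳ-+ n 5 2 ⟨
  7 * n          ∎)
  where open ≤-Reasoning

S-descends-or-smooth : ∀ n → 0 < n → S n < n ⊎ 5 * n + 1 ≡ S n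
S-descends-or-smooth n 0<n with h-cofactor (5 * n + 1) (m≤n+m 1 (5 * n))
... | q , N≡Sn*q , 2∤q , 3∤q with coprime-to-30⇒≡1⊎≥7 q 2∤q 3∤q 5∤q
  where
  5∤q : ¬ 5 ∣ q
  5∤q 5∣q = ∣⇒∤+1 (s<s z<s) (m∣m*n n) (subst (5 ∣_) (sym N≡Sn*q) (∣n⇒∣m*n (S n) 5∣q))
... | inj₁ q≡1 = inj₂ (trans N≡Sn*q (trans (cong (S n *_) q≡1) (*-identityʳ (S n))))
... | inj₂ 7≤q = inj₁ (*≥7⇒< (sym N≡Sn*q) 7≤q 0<n)

-- The values n = 2^a 3^b for which 5n + 1 is again of that form.
data Exceptional : ℕ → Set where
  ex-1  : Exceptional 1
  ex-3  : Exceptional 3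
  ex-16 : Exceptional 16

-- Modulo 9 the left side is 1, forcing 6 ∣ c, so 2^c ≡ 1 (mod 7) while 5 · 3^(2+b) ≢ 0 (mod 7).
5*3^[2+b]+1≢2^c : ∀ b c → 5 * (9 * 3 ^ b) + 1 ≢ 1 * 2 ^ c
5*3^[2+b]+1≢2^c = 5*power+1≢power 63 9 3 6 1 2 6 refl refl (from-yes (avoids5*+1? 63 9 3 6 1 2 6))

-- 544 = 32 · 17. Modulo 32 the left side is 1, forcing 8 ∣ d, so 3^d ≡ ±1 (mod 17),
-- which 5 · 2^(5+a) + 1 never is.
5*2^[5+a]+1≢3^d : ∀ a d → 5 * (32 * 2 ^ a) + 1 ≢ 1 * 3 ^ d
5*2^[5+a]+1≢3^d = 5*power+1≢power 544 32 2 8 1 3 16 refl refl (from-yes (avoids5*+1? 544 32 2 8 1 3 16))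

≢3^ : ∀ x → AvoidsPowers 13 x 1 3 3 → ∀ d → x ≢ 1 * 3 ^ d
≢3^ x = ≢-power 13 x 1 3 3 refl

5*2^[1+a]+1≡3^d⇒exceptional : ∀ a d → 5 * (2 ^ suc a * 1) + 1 ≡ 1 * 3 ^ d → Exceptional (2 ^ suc a * 1)
5*2^[1+a]+1≡3^d⇒exceptional 0 d = ⊥-elim ∘ ≢3^ 11 (from-yes (avoidsPowers? 13 11 1 3 3)) d
5*2^[1+a]+1≡3^d⇒exceptional 1 d = ⊥-elim ∘ ≢3^ 21 (from-yes (avoidsPowers? 13 21 1 3 3)) d
5*2^[1+a]+1≡3^d⇒exceptional 2 d = ⊥-elim ∘ ≢3^ 41 (from-yes (avoidsPowers? 13 41 1 3 3)) d
5*2^[1+a]+1≡3^d⇒exceptional 3 d _ = ex-16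
5*2^[1+a]+1≡3^d⇒exceptional (suc (suc (suc (suc a)))) d eq =
  ⊥-elim (5*2^[5+a]+1≢3^d a d (trans (cong (λ x → 5 * x + 1) 32*2^a≡2^[5+a]*1) eq))
  where
  32*2^a≡2^[5+a]*1 : 32 * 2 ^ a ≡ 2 ^ (5 + a) * 1
  32*2^a≡2^[5+a]*1 = trans (sym (^-distribˡ-+-* 2 5 a)) (sym (*-identityʳ (2 ^ (5 + a))))

5*3^[1+b]+1≡2^c⇒exceptional : ∀ b c → 5 * (1 * 3 ^ suc b) + 1 ≡ 2 ^ c * 1 → Exceptional (1 * 3 ^ suc b)
5*3^[1+b]+1≡2^c⇒exceptional 0       c _  = ex-3
5*3^[1+b]+1≡2^c⇒exceptional (suc b) c eq =
  ⊥-elim (5*3^[2+b]+1≢2^c b c (trans (cong (λ x → 5 * x + 1) 9*3^b≡1*3^[2+b]) (trans eq (*-comm (2 ^ c) 1))))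
  where
  9*3^b≡1*3^[2+b] : 9 * 3 ^ b ≡ 1 * 3 ^ (2 + b)
  9*3^b≡1*3^[2+b] = trans (sym (^-distribˡ-+-* 3 2 b)) (sym (*-identityˡ (3 ^ (2 + b))))

smooth-solutions : ∀ a b c d → 5 * (2 ^ a * 3 ^ b) + 1 ≡ 2 ^ c * 3 ^ d → Exceptional (2 ^ a * 3 ^ b)
smooth-solutions zero    zero    _       _       _  = ex-1
smooth-solutions (suc a) b       (suc c) d       eq =
  ⊥-elim (∣⇒∤+1 (s<s z<s) (∣n⇒∣m*n 5 (∣m⇒∣m*n (3 ^ b) (m∣m*n (2 ^ a))))
           (subst (2 ∣_) (sym eq) (∣m⇒∣m*n (3 ^ d) (m∣m*n (2 ^ c)))))
smooth-solutions a       (suc b) c       (suc d) eq =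
  ⊥-elim (∣⇒∤+1 (s<s z<s) (∣n⇒∣m*n 5 (∣n⇒∣m*n (2 ^ a) (m∣m*n (3 ^ b))))
           (subst (3 ∣_) (sym eq) (∣n⇒∣m*n (2 ^ c) (m∣m*n (3 ^ d)))))
smooth-solutions (suc a) (suc b) zero    zero    eq = ⊥-elim (≢-nonZero⁻¹ (5 * x) (+-cancelʳ-≡ 1 (5 * x) 0 eq))
  where
  x = 2 ^ suc a * 3 ^ suc b
  instance
    _ = m^n≢0 2 (suc a)
    _ = m^n≢0 3 (suc b)
    _ = m*n≢0 (2 ^ suc a) (3 ^ suc b)
    _ = m*n≢0 5 x
smooth-solutions (suc a) zero    zero    d       eq = 5*2^[1+a]+1≡3^d⇒exceptional a d eq
smooth-solutions zero    (suc b) c       zero    eq = 5*3^[1+b]+1≡2^c⇒exceptional b c eq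

S∘S-descends : ∀ x → S (S x) < S x ⊎ Exceptional (S x)
S∘S-descends x =
  map₂ (smooth-solutions (v 2 N) (v 3 N) (v 2 (5 * S x + 1)) (v 3 (5 * S x + 1)))
       (S-descends-or-smooth (S x) (h>0 N))
  where N = 5 * x + 1

exceptional-reaches-1 : ∀ {n} → Exceptional n → ∃[ j ] iterate S n j ≡ 1
exceptional-reaches-1 ex-1  = 0 , refl
exceptional-reaches-1 ex-3  = 4 , refl
exceptional-reaches-1 ex-16 = 3 , refl

cycle-through-1 : ∀ {k} (m : Fin (suc k) → ℕ) → Injective _≡_ _≡_ m →
                  (∀ i → S (m i) ≡ m (rotate i)) → ∀ o → m o ≡ 1 → suc k ≡ 2
cycle-through-1 m injective cycle o mo≡1 =
  rotate²≡id⇒order-2 o (injective (trans m[ρ²o]≡1 (sym mo≡1)))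
    λ ρo≡o → 6≢1 (trans (sym m[ρo]≡6) (trans (cong m ρo≡o) mo≡1))
  where
  m[ρo]≡6 : m (rotate o) ≡ 6
  m[ρo]≡6 = trans (sym (cycle o)) (cong S mo≡1)
  m[ρ²o]≡1 : m (rotate (rotate o)) ≡ 1
  m[ρ²o]≡1 = trans (sym (cycle (rotate o))) (cong S m[ρo]≡6)
  6≢1 : 6 ≢ 1
  6≢1 ()

corollary4p4 : (k : ℕ) → (m : Fin (suc k) → ℕ)
    → Injective _≡_ _≡_ m
    → (∀ i → 0 < m i)
    → (∀ i → S (m i) ≡ m (fromℕ< (m%n<n (suc (toℕ i)) (suc k))))
    → suc k ≡ 2
corollary4p4 k m injective _ cycle =
  let i , exceptional = descent (m ∘ rotate) rotate descends zero
      j , Sʲ≡1        = exceptional-reaches-1 exceptional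
  in cycle-through-1 m injective cycle (iterate rotate (rotate i) j)
       (trans (sym (iterate-equivariant m cycle (rotate i) j)) Sʲ≡1)
  where
  descends : ∀ i → Exceptional (m (rotate i)) ⊎ m (rotate (rotate i)) < m (rotate i)
  descends i = subst₂ (λ x y → Exceptional x ⊎ y < x) (cycle i) (trans (cong S (cycle i)) (cycle (rotate i)))
                 (swap (S∘S-descends (m i)))
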